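{- Let $x_1,\dots,x_n,a,b$ be distinct integers and let $f\colon\{x_1,\dots,x_n,a,b\}\to\mathbb Z$ be a function whose interpolation polynomial (the unique polynomial in $\mathbb Q[x]$ of degree at most $n+1$ agreeing with $f$ on these $n+2$ points) is not in $\mathbb Z[x]$, while the restrictions of $f$ to $\{x_1,\dots,x_n,a\}$ and to $\{x_1,\dots,x_n,b\}$ are each given by some polynomial in $\mathbb Z[x]$. Then: (1) $|a-b|\ge 2$; (2) letting $V=\{x\in\mathbb Z:\gcd(x-a,a-b)=1\}$ and $U=\{x_1,\dots,x_n\}\cup V$, there exists a function $g\colon U\cup\{a,b\}\to\mathbb Z$ that agrees with $f$ on $\{x_1,\dots,x_n,a,b\}$ and whose restrictions to $U\cup\{a\}$ and to $U\cup\{b\}$ are LIP.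
   Context: For $S\subseteq\mathbb Z$, a function $h\colon S\to\mathbb Z$ is LIP on $S$ if for every finite $X\subseteq S$ there is $p\in\mathbb Z[x]$ with $p(x)=h(x)$ for all $x\in X$. (Note $a,b\notin V$.) -}

module Defs where

open import Data.Nat using (ℕ)
open import Data.Integer using (ℤ; _+_; _*_; _-_; +_; 0ℤ)
open import Data.Integer.GCD using (gcd)
open import Data.List using (List; []; _∷_; length)
open import Data.List.Relation.Unary.All using (All)
open import Data.List.Membership.Propositional using (_∈_)
open import Data.Fin using (Fin)
open import Data.Product using (Σ; ∃; _×_)
open import Data.Sum using (_⊎_)
open import Relation.Binary.PropositionalEquality using (_≡_)

-- Polynomials in ℤ[x] as coefficient lists, constant term first:
-- c₀ ∷ c₁ ∷ … represents c₀ + c₁ x + c₂ x² + …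
Poly : Set
Poly = List ℤ

eval : Poly → ℤ → ℤ
eval []       y = 0ℤ
eval (c ∷ cs) y = c + y * eval cs y

InRange : {n : ℕ} → (Fin n → ℤ) → ℤ → Set
InRange {n} x y = ∃ λ (i : Fin n) → y ≡ x i

-- h : S → ℤ is LIP on S: every finite X ⊆ S admits p ∈ ℤ[x] with p = h on X.
-- (h is given as a total function ℤ → ℤ; only its values on S matter.)
LIP : (S : ℤ → Set) → (h : ℤ → ℤ) → Set
LIP S h = (X : List ℤ) → All S X →
  Σ Poly λ p → (y : ℤ) → y ∈ X → eval p y ≡ h y

V : ℤ → ℤ → ℤ → Set
V a b y = gcd (y - a) (a - b) ≡ + 1

U : {n : ℕ} → (Fin n → ℤ) → ℤ → ℤ → ℤ → Set
U x a b y = InRange x y ⊎ V a b y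

UWith : {n : ℕ} → (Fin n → ℤ) → ℤ → ℤ → ℤ → ℤ → Set
UWith x a b c y = U x a b y ⊎ y ≡ c

{-# OPTIONS --safe #-}
module Submission where

-- Let P and Q be integer polynomials interpolating f on x₁,…,xₙ,a and on x₁,…,xₙ,b, and
-- M = ∏ (t - xᵢ); then Q = P + M·S with S integral. For y ∈ V, Bézout gives
-- S(y) = (y - a)c + (y - b)d, and replacing P by P + M·(t - a)c and Q by Q - M·(t - b)d keeps
-- both interpolation properties while making the new S vanish at y, so that M·(t - y) can
-- take the role of M. Once M vanishes at y (y is settled), P(y) = Q(y), and later steps,
-- which only add multiples of M, never change this value. Settling the points of V along an
-- enumeration of ℤ defines g as the limit; every finite set is settled at some stage, where
-- P (resp. Q) is an integer polynomial agreeing with g on it. If |a - b| = 1 then b ∈ V, and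
-- a single step gives an integer interpolant on all n + 2 points, of degree ≤ n + 1 after
-- reduction.

module Interpolation where

  open import Defs
  open import Data.Nat as ℕ using (ℕ; zero; suc; _≤′_; ≤′-refl; ≤′-step; s≤s; z≤n)
  open import Data.Nat.Properties using (≤⇒≤′)
  open import Data.Nat.Coprimality using (coprime-Bézout; gcd≡1⇒coprime)
  open import Data.Nat.GCD using (module Bézout) renaming (gcd to gcdℕ)
  open import Data.Integer
    using (ℤ; +_; -[1+_]; 0ℤ; 1ℤ; -1ℤ; _+_; _-_; _*_; -_; ∣_∣; _≟_)
  open import Data.Integer.Properties
    using ( +-identityˡ; +-identityʳ; *-identityˡ; *-identityʳ; *-zeroˡ; *-zeroʳ; -1*i≡-i
          ; +-injective; pos-+; pos-*; +∣i∣≡i⊎+∣i∣≡-i; ∣i-j∣≡∣j-i∣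
          ; +-inverseʳ; *-assoc; i-j≡0⇒i≡j; i*j≡0⇒i≡0∨j≡0; ∣i∣≡0⇒i≡0)
  open import Data.Integer.GCD using (gcd)
  open import Data.Integer.Tactic.RingSolver using (solve-∀)
  open import Data.List using (List; []; _∷_; length; map; tabulate)
  open import Data.List.Properties using (length-tabulate)
  open import Data.List.Extrema.Nat using (argmax; f[xs]≤f[argmax])
  open import Data.List.Membership.Propositional using (_∈_)
  open import Data.List.Membership.Propositional.Properties using (∈-tabulate⁺)
  open import Data.List.Relation.Unary.Any using (here; there)
  import Data.List.Relation.Unary.All as All
  open import Data.Fin as Fin using (Fin)
  open import Data.Fin.Properties using (suc-injective)
  open import Data.Product using (Σ; ∃₂; _×_; _,_; proj₁; proj₂)
  open import Data.Sum using (inj₁; inj₂)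
  open import Function using (_∘_)
  open import Function.Definitions using (Injective)
  open import Relation.Nullary using (¬_; yes; no; contradiction)
  open import Relation.Binary.PropositionalEquality
    using (_≡_; _≢_; refl; sym; trans; cong; cong₂; subst; module ≡-Reasoning)

  infixl 6 _+ₚ_
  infixl 7 _·ₚ_ _*ₚ_

  _+ₚ_ : Poly → Poly → Poly
  []       +ₚ q        = q
  (c ∷ cs) +ₚ []       = c ∷ cs
  (c ∷ cs) +ₚ (d ∷ ds) = c + d ∷ cs +ₚ ds

  _·ₚ_ : ℤ → Poly → Poly
  c ·ₚ p = map (c *_) p

  _*ₚ_ : Poly → Poly → Poly
  []       *ₚ q = []
  (c ∷ cs) *ₚ q = c ·ₚ q +ₚ (0ℤ ∷ cs *ₚ q)

  eval-+ₚ : ∀ p q t → eval (p +ₚ q) t ≡ eval p t + eval q t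
  eval-+ₚ []       q        t = sym (+-identityˡ _)
  eval-+ₚ (c ∷ cs) []       t = sym (+-identityʳ _)
  eval-+ₚ (c ∷ cs) (d ∷ ds) t =
    trans (cong (λ e → c + d + t * e) (eval-+ₚ cs ds t)) (ring c d t (eval cs t) (eval ds t))
    where
    ring : ∀ c d t u v → c + d + t * (u + v) ≡ c + t * u + (d + t * v)
    ring = solve-∀

  eval-·ₚ : ∀ c p t → eval (c ·ₚ p) t ≡ c * eval p t
  eval-·ₚ c []       t = sym (*-zeroʳ c)
  eval-·ₚ c (d ∷ ds) t =
    trans (cong (λ e → c * d + t * e) (eval-·ₚ c ds t)) (ring c d t (eval ds t))
    where
    ring : ∀ c d t u → c * d + t * (c * u) ≡ c * (d + t * u)
    ring = solve-∀

  eval-*ₚ : ∀ p q t → eval (p *ₚ q) t ≡ eval p t * eval q t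
  eval-*ₚ []       q t = sym (*-zeroˡ (eval q t))
  eval-*ₚ (c ∷ cs) q t = begin
    eval (c ·ₚ q +ₚ (0ℤ ∷ cs *ₚ q)) t
      ≡⟨ eval-+ₚ (c ·ₚ q) _ t ⟩
    eval (c ·ₚ q) t + (0ℤ + t * eval (cs *ₚ q) t)
      ≡⟨ cong₂ (λ u v → u + (0ℤ + t * v)) (eval-·ₚ c q t) (eval-*ₚ cs q t) ⟩
    c * eval q t + (0ℤ + t * (eval cs t * eval q t))
      ≡⟨ ring c t (eval cs t) (eval q t) ⟩
    (c + t * eval cs t) * eval q t ∎
    where
    open ≡-Reasoning
    ring : ∀ c t u v → c * v + (0ℤ + t * (u * v)) ≡ (c + t * u) * v
    ring = solve-∀

  IsPolynomial : (ℤ → ℤ) → Set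
  IsPolynomial h = Σ Poly λ p → ∀ t → eval p t ≡ h t

  poly-const : ∀ c → IsPolynomial (λ _ → c)
  poly-const c = c ∷ [] , λ t → ring c t
    where
    ring : ∀ c t → c + t * 0ℤ ≡ c
    ring = solve-∀

  poly-linear : ∀ z → IsPolynomial (λ t → t - z)
  poly-linear z = - z ∷ 1ℤ ∷ [] , λ t → ring z t
    where
    ring : ∀ z t → - z + t * (1ℤ + t * 0ℤ) ≡ t - z
    ring = solve-∀

  poly-add : ∀ {h k} → IsPolynomial h → IsPolynomial k → IsPolynomial (λ t → h t + k t)
  poly-add (p , p≡h) (q , q≡k) = p +ₚ q , λ t → trans (eval-+ₚ p q t) (cong₂ _+_ (p≡h t) (q≡k t))

  poly-mul : ∀ {h k} → IsPolynomial h → IsPolynomial k → IsPolynomial (λ t → h t * k t)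
  poly-mul (p , p≡h) (q , q≡k) = p *ₚ q , λ t → trans (eval-*ₚ p q t) (cong₂ _*_ (p≡h t) (q≡k t))

  poly-sub : ∀ {h k} → IsPolynomial h → IsPolynomial k → IsPolynomial (λ t → h t - k t)
  poly-sub {h} {k} (p , p≡h) (q , q≡k) = p +ₚ -1ℤ ·ₚ q , λ t → begin
    eval (p +ₚ -1ℤ ·ₚ q) t
      ≡⟨ eval-+ₚ p _ t ⟩
    eval p t + eval (-1ℤ ·ₚ q) t
      ≡⟨ cong₂ _+_ (p≡h t) (trans (eval-·ₚ -1ℤ q t) (-1*i≡-i (eval q t))) ⟩
    h t - eval q t
      ≡⟨ cong (λ e → h t - e) (q≡k t) ⟩
    h t - k t ∎
    where open ≡-Reasoning

  quotient : Poly → ℤ → Poly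
  quotient []       z = []
  quotient (c ∷ cs) z = eval cs z ∷ quotient cs z

  eval-quotient : ∀ p z t → eval p t ≡ eval p z + (t - z) * eval (quotient p z) t
  eval-quotient []       z t = ring t z
    where
    ring : ∀ t z → 0ℤ ≡ 0ℤ + (t - z) * 0ℤ
    ring = solve-∀
  eval-quotient (c ∷ cs) z t =
    trans (cong (λ e → c + t * e) (eval-quotient cs z t)) (ring c t z (eval cs z) (eval (quotient cs z) t))
    where
    ring : ∀ c t z u v → c + t * (u + (t - z) * v) ≡ c + z * u + (t - z) * (u + t * v)
    ring = solve-∀

  factor-root : ∀ {h} → IsPolynomial h → ∀ {z} → h z ≡ 0ℤ →
                Σ (ℤ → ℤ) λ h₁ → IsPolynomial h₁ × (∀ t → h t ≡ (t - z) * h₁ t)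
  factor-root {h} (p , p≡h) {z} hz≡0 = h₁ , (quotient p z , λ _ → refl) , λ t → begin
    h t                     ≡⟨ sym (p≡h t) ⟩
    eval p t                ≡⟨ eval-quotient p z t ⟩
    eval p z + (t - z) * h₁ t ≡⟨ cong (_+ (t - z) * h₁ t) (trans (p≡h z) hz≡0) ⟩
    0ℤ + (t - z) * h₁ t     ≡⟨ +-identityˡ _ ⟩
    (t - z) * h₁ t          ∎
    where
    open ≡-Reasoning
    h₁ : ℤ → ℤ
    h₁ = eval (quotient p z)

  newton : ℤ → ℤ → Poly → Poly
  newton c z []       = c ∷ []
  newton c z (d ∷ ds) = c - z * d ∷ newton d z ds

  length-newton : ∀ c z q → length (newton c z q) ≡ suc (length q)
  length-newton c z []       = refl
  length-newton c z (d ∷ ds) = cong suc (length-newton d z ds)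

  eval-newton : ∀ c z q t → eval (newton c z q) t ≡ c + (t - z) * eval q t
  eval-newton c z []       t = ring c t z
    where
    ring : ∀ c t z → c + t * 0ℤ ≡ c + (t - z) * 0ℤ
    ring = solve-∀
  eval-newton c z (d ∷ ds) t =
    trans (cong (λ e → c - z * d + t * e) (eval-newton d z ds t)) (ring c z d t (eval ds t))
    where
    ring : ∀ c z d t u → c - z * d + t * (d + (t - z) * u) ≡ c + (t - z) * (d + t * u)
    ring = solve-∀

  reduce-degree : ∀ p (L : List ℤ) →
                  Σ Poly λ q → length q ℕ.≤ length L × (∀ {w} → w ∈ L → eval q w ≡ eval p w)
  reduce-degree p []      = [] , z≤n , λ ()
  reduce-degree p (z ∷ L) with reduce-degree (quotient p z) L
  ... | q , q≤L , q≡quotient = newton (eval p z) z q , length≤ , agrees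
    where
    length≤ : length (newton (eval p z) z q) ℕ.≤ suc (length L)
    length≤ = subst (ℕ._≤ suc (length L)) (sym (length-newton (eval p z) z q)) (s≤s q≤L)
    agrees : ∀ {w} → w ∈ z ∷ L → eval (newton (eval p z) z q) w ≡ eval p w
    agrees (here refl) = trans (eval-newton (eval p z) z q z) (ring (eval p z) z (eval q z))
      where
      ring : ∀ c z u → c + (z - z) * u ≡ c
      ring = solve-∀
    agrees {w} (there w∈L) = begin
      eval (newton (eval p z) z q) w          ≡⟨ eval-newton (eval p z) z q w ⟩
      eval p z + (w - z) * eval q w           ≡⟨ cong (λ e → eval p z + (w - z) * e) (q≡quotient w∈L) ⟩
      eval p z + (w - z) * eval (quotient p z) w ≡⟨ sym (eval-quotient p z w) ⟩
      eval p w                                ∎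
      where open ≡-Reasoning

  nodal : ∀ {n} → (Fin n → ℤ) → ℤ → ℤ
  nodal {zero}  x t = 1ℤ
  nodal {suc n} x t = (t - x Fin.zero) * nodal (x ∘ Fin.suc) t

  poly-nodal : ∀ {n} (x : Fin n → ℤ) → IsPolynomial (nodal x)
  poly-nodal {zero}  x = poly-const 1ℤ
  poly-nodal {suc n} x = poly-mul (poly-linear (x Fin.zero)) (poly-nodal (x ∘ Fin.suc))

  nodal-vanishes : ∀ {n} (x : Fin n → ℤ) i → nodal x (x i) ≡ 0ℤ
  nodal-vanishes x Fin.zero = trans (cong (_* rest) (+-inverseʳ (x Fin.zero))) (*-zeroˡ rest)
    where
    rest = nodal (x ∘ Fin.suc) (x Fin.zero)
  nodal-vanishes x (Fin.suc i) = trans (cong (head *_) (nodal-vanishes (x ∘ Fin.suc) i)) (*-zeroʳ head)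
    where
    head = x (Fin.suc i) - x Fin.zero

  quotient-vanishes : ∀ {h h₁ : ℤ → ℤ} {z} w →
                      (∀ t → h t ≡ (t - z) * h₁ t) → h w ≡ 0ℤ → w ≢ z → h₁ w ≡ 0ℤ
  quotient-vanishes {z = z} w h≡ hw≡0 w≢z with i*j≡0⇒i≡0∨j≡0 (w - z) (trans (sym (h≡ w)) hw≡0)
  ... | inj₁ w-z≡0 = contradiction (i-j≡0⇒i≡j w z w-z≡0) w≢z
  ... | inj₂ h₁w≡0 = h₁w≡0

  nodal-divides : ∀ {n} (x : Fin n → ℤ) → Injective _≡_ _≡_ x →
                  ∀ {h} → IsPolynomial h → (∀ i → h (x i) ≡ 0ℤ) →
                  Σ (ℤ → ℤ) λ k → IsPolynomial k × (∀ t → h t ≡ nodal x t * k t)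
  nodal-divides {zero}  x x-inj {h} h-poly h-roots = h , h-poly , λ t → sym (*-identityˡ (h t))
  nodal-divides {suc n} x x-inj h-poly h-roots with factor-root h-poly (h-roots Fin.zero)
  ... | h₁ , h₁-poly , h≡ with nodal-divides (x ∘ Fin.suc) (suc-injective ∘ x-inj) h₁-poly
         (λ i → quotient-vanishes (x (Fin.suc i)) h≡ (h-roots (Fin.suc i)) ((λ ()) ∘ x-inj))
  ... | k , k-poly , h₁≡ = k , k-poly , λ t →
    trans (h≡ t) (trans (cong ((t - x Fin.zero) *_) (h₁≡ t)) (sym (*-assoc (t - x Fin.zero) _ _)))

  sign-unit : ∀ i → Σ ℤ λ s → s * i ≡ + ∣ i ∣
  sign-unit i with +∣i∣≡i⊎+∣i∣≡-i i
  ... | inj₁ ∣i∣≡i  = 1ℤ  , trans (*-identityˡ i) (sym ∣i∣≡i)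
  ... | inj₂ ∣i∣≡-i = -1ℤ , trans (-1*i≡-i i) (sym ∣i∣≡-i)

  1+yn≡xm⇒xm-yn≡1 : ∀ {m n} x y → 1 ℕ.+ y ℕ.* n ≡ x ℕ.* m → + x * + m - + y * + n ≡ 1ℤ
  1+yn≡xm⇒xm-yn≡1 {m} {n} x y eq = begin
    + x * + m - + y * + n         ≡⟨ cong₂ (λ u v → u - v) (sym (pos-* x m)) (sym (pos-* y n)) ⟩
    + (x ℕ.* m) - + (y ℕ.* n)     ≡⟨ cong (λ u → + u - + (y ℕ.* n)) (sym eq) ⟩
    + (1 ℕ.+ y ℕ.* n) - + (y ℕ.* n) ≡⟨ cong (_- + (y ℕ.* n)) (pos-+ 1 (y ℕ.* n)) ⟩
    1ℤ + + (y ℕ.* n) - + (y ℕ.* n)  ≡⟨ ring (+ (y ℕ.* n)) ⟩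
    1ℤ                              ∎
    where
    open ≡-Reasoning
    ring : ∀ k → 1ℤ + k - k ≡ 1ℤ
    ring = solve-∀

  bézout : ∀ i j → gcd i j ≡ 1ℤ → ∃₂ λ u v → u * i + v * j ≡ 1ℤ
  bézout i j gcd≡1 with coprime-Bézout (gcd≡1⇒coprime (+-injective gcd≡1)) | sign-unit i | sign-unit j
  ... | Bézout.+- x y eq | s , si | r , rj = + x * s , - (+ y * r) , (begin
    + x * s * i + - (+ y * r) * j  ≡⟨ ring (+ x) s i (+ y) r j ⟩
    + x * (s * i) - + y * (r * j)  ≡⟨ cong₂ (λ u v → + x * u - + y * v) si rj ⟩
    + x * + ∣ i ∣ - + y * + ∣ j ∣  ≡⟨ 1+yn≡xm⇒xm-yn≡1 x y eq ⟩
    1ℤ                             ∎)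
    where
    open ≡-Reasoning
    ring : ∀ x s i y r j → x * s * i + - (y * r) * j ≡ x * (s * i) - y * (r * j)
    ring = solve-∀
  ... | Bézout.-+ x y eq | s , si | r , rj = - (+ x * s) , + y * r , (begin
    - (+ x * s) * i + + y * r * j  ≡⟨ ring (+ x) s i (+ y) r j ⟩
    + y * (r * j) - + x * (s * i)  ≡⟨ cong₂ (λ u v → + y * v - + x * u) si rj ⟩
    + y * + ∣ j ∣ - + x * + ∣ i ∣  ≡⟨ 1+yn≡xm⇒xm-yn≡1 y x eq ⟩
    1ℤ                             ∎)
    where
    open ≡-Reasoning
    ring : ∀ x s i y r j → - (x * s) * i + y * r * j ≡ y * (r * j) - x * (s * i)
    ring = solve-∀

  coprime-split : ∀ a b y → V a b y →
                  ∀ e → ∃₂ λ c d → e ≡ (y - a) * c + (y - b) * d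
  coprime-split a b y y∈V e with bézout (y - a) (a - b) y∈V
  ... | u , v , bz = e * (u - v) , e * v , (begin
    e                                             ≡⟨ sym (*-identityʳ e) ⟩
    e * 1ℤ                                        ≡⟨ cong (e *_) (sym bz) ⟩
    e * (u * (y - a) + v * (a - b))               ≡⟨ ring e u v y a b ⟩
    (y - a) * (e * (u - v)) + (y - b) * (e * v)   ∎)
    where
    open ≡-Reasoning
    ring : ∀ e u v y a b → e * (u * (y - a) + v * (a - b)) ≡ (y - a) * (e * (u - v)) + (y - b) * (e * v)
    ring = solve-∀

  record Correction (a b y : ℤ) (S : ℤ → ℤ) : Set where
    field
      c d           : ℤ
      S₁            : ℤ → ℤ
      S₁-poly       : IsPolynomial S₁
      decomposition : ∀ t → S t ≡ (t - a) * c + (t - b) * d + (t - y) * S₁ t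

  correction : ∀ a b y {S} → IsPolynomial S → V a b y → Correction a b y S
  correction a b y {S} S-poly y∈V = record
    { c = c ; d = d ; S₁ = proj₁ division ; S₁-poly = proj₁ (proj₂ division)
    ; decomposition = λ t → trans (ring (S t) (R t)) (cong (λ e → R t + e) (proj₂ (proj₂ division) t))
    }
    where
    split = coprime-split a b y y∈V (S y)
    c = proj₁ split
    d = proj₁ (proj₂ split)
    R : ℤ → ℤ
    R t = (t - a) * c + (t - b) * d
    R-poly : IsPolynomial R
    R-poly = poly-add (poly-mul (poly-linear a) (poly-const c)) (poly-mul (poly-linear b) (poly-const d))
    division = factor-root (poly-sub S-poly R-poly)
                 (trans (cong (_- R y) (proj₂ (proj₂ split))) (+-inverseʳ (R y)))
    ring : ∀ s r → s ≡ r + (s - r)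
    ring = solve-∀

  rank : ℤ → ℕ
  rank (+ k)    = k
  rank -[1+ k ] = k

  LIP-by-approximation : ∀ {S h} (F : ℕ → ℤ → ℤ) → (∀ K → IsPolynomial (F K)) →
                         (∀ {K y} → S y → rank y ℕ.< K → F K y ≡ h y) → LIP S h
  LIP-by-approximation F F-poly F≡h X X⊆S = proj₁ (F-poly K) , λ y y∈X →
    trans (proj₂ (F-poly K) y)
          (F≡h (All.lookup X⊆S y∈X) (s≤s (All.lookup (f[xs]≤f[argmax] {f = rank} 0ℤ X) y∈X)))
    where
    K : ℕ
    K = suc (rank (argmax rank 0ℤ X))

  adjacent⇒b∈V : ∀ a b → ∣ a - b ∣ ≡ 1 → V a b b
  adjacent⇒b∈V a b ∣a-b∣≡1 =
    cong₂ (λ m k → + gcdℕ m k) (trans (∣i-j∣≡∣j-i∣ b a) ∣a-b∣≡1) ∣a-b∣≡1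

  m≡0⇒p+m*k≡p : ∀ {m} p k → m ≡ 0ℤ → p + m * k ≡ p
  m≡0⇒p+m*k≡p p k refl = trans (cong (λ e → p + e) (*-zeroˡ k)) (+-identityʳ p)

  module Construction
    {n} (x : Fin n → ℤ) (a b : ℤ) (f : ℤ → ℤ)
    (x-injective : Injective _≡_ _≡_ x) (x≢b : ∀ i → x i ≢ b) (a≢b : a ≢ b)
    (p : Poly) (p-nodes : ∀ i → eval p (x i) ≡ f (x i)) (p-a : eval p a ≡ f a)
    (q : Poly) (q-nodes : ∀ i → eval q (x i) ≡ f (x i)) (q-b : eval q b ≡ f b)
    where

    record Interpolants : Set where
      field
        P M S   : ℤ → ℤ
        P-poly  : IsPolynomial P
        M-poly  : IsPolynomial M
        S-poly  : IsPolynomial S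
        P-nodes : ∀ i → P (x i) ≡ f (x i)
        P-a     : P a ≡ f a
        M-nodes : ∀ i → M (x i) ≡ 0ℤ
        Q-b     : P b + M b * S b ≡ f b

      Q : ℤ → ℤ
      Q t = P t + M t * S t

      Q-poly : IsPolynomial Q
      Q-poly = poly-add P-poly (poly-mul M-poly S-poly)

      Q≡P : ∀ {t} → M t ≡ 0ℤ → Q t ≡ P t
      Q≡P {t} = m≡0⇒p+m*k≡p (P t) (S t)

      P-b : M b ≡ 0ℤ → P b ≡ f b
      P-b Mb≡0 = trans (sym (Q≡P Mb≡0)) Q-b

    open Interpolants

    initial : Interpolants
    initial = record
      { P = eval p ; M = nodal x ; S = proj₁ division
      ; P-poly = p , λ _ → refl ; M-poly = poly-nodal x ; S-poly = proj₁ (proj₂ division)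
      ; P-nodes = p-nodes ; P-a = p-a ; M-nodes = nodal-vanishes x
      ; Q-b = trans (cong (λ e → eval p b + e) (sym (proj₂ (proj₂ division) b)))
                    (trans (ring (eval p b) (eval q b)) q-b)
      }
      where
      division = nodal-divides x x-injective (poly-sub (q , λ _ → refl) (p , λ _ → refl))
                   λ i → trans (cong₂ _-_ (q-nodes i) (p-nodes i)) (+-inverseʳ (f (x i)))
      ring : ∀ u v → u + (v - u) ≡ v
      ring = solve-∀

    record _⊑_ (s s′ : Interpolants) : Set where
      field keep : ∀ {t} → M s t ≡ 0ℤ → M s′ t ≡ 0ℤ × P s′ t ≡ P s t

    open _⊑_

    ⊑-refl : ∀ {s} → s ⊑ s
    ⊑-refl = record { keep = λ Mt≡0 → Mt≡0 , refl }

    ⊑-trans : ∀ {s s′ s″} → s ⊑ s′ → s′ ⊑ s″ → s ⊑ s″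
    ⊑-trans s⊑s′ s′⊑s″ = record { keep = λ Mt≡0 →
      let M′t≡0 , P′≡P = keep s⊑s′ Mt≡0
          M″t≡0 , P″≡P′ = keep s′⊑s″ M′t≡0
      in M″t≡0 , trans P″≡P′ P′≡P }

    module Extension (s : Interpolants) (y : ℤ) (y∈V : V a b y) where
      open Correction (correction a b y (S-poly s) y∈V)

      extended : Interpolants
      extended = record
        { P = λ t → P s t + M s t * ((t - a) * c)
        ; M = λ t → M s t * (t - y)
        ; S = S₁
        ; P-poly = poly-add (P-poly s) (poly-mul (M-poly s) (poly-mul (poly-linear a) (poly-const c)))
        ; M-poly = poly-mul (M-poly s) (poly-linear y)
        ; S-poly = S₁-poly
        ; P-nodes = λ i → trans (m≡0⇒p+m*k≡p _ _ (M-nodes s i)) (P-nodes s i)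
        ; P-a = trans (ring-a (P s a) (M s a) a c) (P-a s)
        ; M-nodes = λ i → trans (cong (_* (x i - y)) (M-nodes s i)) (*-zeroˡ (x i - y))
        -- the new Q is Q - M·(t - b)·d, which agrees with Q at b
        ; Q-b = begin
            P s b + M s b * ((b - a) * c) + M s b * (b - y) * S₁ b
              ≡⟨ ring-b (P s b) (M s b) a b c d y (S₁ b) ⟩
            P s b + M s b * ((b - a) * c + (b - b) * d + (b - y) * S₁ b)
              ≡⟨ cong (λ e → P s b + M s b * e) (sym (decomposition b)) ⟩
            P s b + M s b * S s b
              ≡⟨ Q-b s ⟩
            f b ∎
        }
        where
        open ≡-Reasoning
        ring-a : ∀ p m a c → p + m * ((a - a) * c) ≡ p
        ring-a = solve-∀
        ring-b : ∀ p m a b c d y s →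
                 p + m * ((b - a) * c) + m * (b - y) * s ≡ p + m * ((b - a) * c + (b - b) * d + (b - y) * s)
        ring-b = solve-∀

      extended-settles : M extended y ≡ 0ℤ
      extended-settles = trans (cong (M s y *_) (+-inverseʳ y)) (*-zeroʳ (M s y))

      extended-⊑ : s ⊑ extended
      extended-⊑ = record { keep = λ {t} Mt≡0 →
        trans (cong (_* (t - y)) Mt≡0) (*-zeroˡ (t - y)) , m≡0⇒p+m*k≡p _ _ Mt≡0 }

    open Extension using (extended; extended-settles; extended-⊑)

    absorb : Interpolants → ℤ → Interpolants
    absorb s y with gcd (y - a) (a - b) ≟ 1ℤ
    ... | yes y∈V = extended s y y∈V
    ... | no _    = s

    absorb-⊑ : ∀ s y → s ⊑ absorb s y
    absorb-⊑ s y with gcd (y - a) (a - b) ≟ 1ℤ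
    ... | yes y∈V = extended-⊑ s y y∈V
    ... | no _    = ⊑-refl

    absorb-settles : ∀ s y → V a b y → M (absorb s y) y ≡ 0ℤ
    absorb-settles s y y∈V with gcd (y - a) (a - b) ≟ 1ℤ
    ... | yes y∈V′ = extended-settles s y y∈V′
    ... | no y∉V   = contradiction y∈V y∉V

    stage : ℕ → Interpolants
    stage zero    = initial
    stage (suc k) = absorb (absorb (stage k) (+ k)) -[1+ k ]

    stage-suc-⊑ : ∀ k → stage k ⊑ stage (suc k)
    stage-suc-⊑ k = ⊑-trans (absorb-⊑ (stage k) (+ k)) (absorb-⊑ (absorb (stage k) (+ k)) -[1+ k ])

    stage-⊑ : ∀ {j k} → j ≤′ k → stage j ⊑ stage k
    stage-⊑ ≤′-refl                   = ⊑-refl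
    stage-⊑ {k = suc k} (≤′-step j≤k) = ⊑-trans (stage-⊑ j≤k) (stage-suc-⊑ k)

    stage-settles : ∀ {y} → V a b y → M (stage (suc (rank y))) y ≡ 0ℤ
    stage-settles {+ k}      y∈V =
      proj₁ (keep (absorb-⊑ (absorb (stage k) (+ k)) -[1+ k ]) (absorb-settles (stage k) (+ k) y∈V))
    stage-settles { -[1+ k ]} y∈V = absorb-settles (absorb (stage k) (+ k)) -[1+ k ] y∈V

    stays-settled : ∀ {K y} → V a b y → rank y ℕ.< K →
                   M (stage K) y ≡ 0ℤ × P (stage K) y ≡ P (stage (suc (rank y))) y
    stays-settled y∈V r<K = keep (stage-⊑ (≤⇒≤′ r<K)) (stage-settles y∈V)

    LowDegreeInterpolant : Set
    LowDegreeInterpolant = Σ Poly λ r → length r ℕ.≤ 2 ℕ.+ n ×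
      (∀ i → eval r (x i) ≡ f (x i)) × eval r a ≡ f a × eval r b ≡ f b

    low-degree : ∀ {h} → IsPolynomial h →
                 (∀ i → h (x i) ≡ f (x i)) → h a ≡ f a → h b ≡ f b → LowDegreeInterpolant
    low-degree {h} (r , r≡h) h-nodes h-a h-b with reduce-degree r (a ∷ b ∷ tabulate x)
    ... | r′ , r′≤ , r′≡r =
      r′ , subst (λ l → length r′ ℕ.≤ 2 ℕ.+ l) (length-tabulate x) r′≤ ,
      (λ i → agrees (there (there (∈-tabulate⁺ i))) (h-nodes i)) ,
      agrees (here refl) h-a , agrees (there (here refl)) h-b
      where
      agrees : ∀ {w} → w ∈ a ∷ b ∷ tabulate x → h w ≡ f w → eval r′ w ≡ f w
      agrees {w} w∈ hw≡fw = trans (r′≡r w∈) (trans (r≡h w) hw≡fw)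

    separated : ¬ LowDegreeInterpolant → 2 ℕ.≤ ∣ a - b ∣
    separated no-interpolant with ∣ a - b ∣ in ∣a-b∣≡
    ... | 0           = contradiction (i-j≡0⇒i≡j a b (∣i∣≡0⇒i≡0 ∣a-b∣≡)) a≢b
    ... | 1           = contradiction
      (low-degree (P-poly s) (P-nodes s) (P-a s) (P-b s (extended-settles initial b b∈V))) no-interpolant
      where
      b∈V = adjacent⇒b∈V a b ∣a-b∣≡
      s = extended initial b b∈V
    ... | suc (suc _) = s≤s (s≤s z≤n)

    g : ℤ → ℤ
    g y with y ≟ b
    ... | yes _ = f b
    ... | no _  = P (stage (suc (rank y))) y

    g-off-b : ∀ {y} → y ≢ b → g y ≡ P (stage (suc (rank y))) y
    g-off-b {y} y≢b with y ≟ b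
    ... | yes y≡b = contradiction y≡b y≢b
    ... | no _    = refl

    g-b : g b ≡ f b
    g-b with b ≟ b
    ... | yes _  = refl
    ... | no b≢b = contradiction refl b≢b

    g-nodes : ∀ i → g (x i) ≡ f (x i)
    g-nodes i = trans (g-off-b (x≢b i)) (P-nodes (stage (suc (rank (x i)))) i)

    g-a : g a ≡ f a
    g-a = trans (g-off-b a≢b) (P-a (stage (suc (rank a))))

    P-agrees-on-V : ∀ {K y} → V a b y → rank y ℕ.< K → P (stage K) y ≡ g y
    P-agrees-on-V {K} {y} y∈V r<K with y ≟ b | stays-settled y∈V r<K
    ... | yes refl | M≡0 , _ = P-b (stage K) M≡0
    ... | no _     | _ , P≡P = P≡P

    P-agrees : ∀ {K y} → UWith x a b a y → rank y ℕ.< K → P (stage K) y ≡ g y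
    P-agrees {K} (inj₁ (inj₁ (i , refl))) _   = trans (P-nodes (stage K) i) (sym (g-nodes i))
    P-agrees     (inj₁ (inj₂ y∈V))        r<K = P-agrees-on-V y∈V r<K
    P-agrees {K} (inj₂ refl)              _   = trans (P-a (stage K)) (sym g-a)

    M-vanishes-on-U : ∀ {K y} → U x a b y → rank y ℕ.< K → M (stage K) y ≡ 0ℤ
    M-vanishes-on-U {K} (inj₁ (i , refl)) _   = M-nodes (stage K) i
    M-vanishes-on-U     (inj₂ y∈V)        r<K = proj₁ (stays-settled y∈V r<K)

    Q-agrees : ∀ {K y} → UWith x a b b y → rank y ℕ.< K → Q (stage K) y ≡ g y
    Q-agrees {K} (inj₁ y∈U) r<K =
      trans (Q≡P (stage K) (M-vanishes-on-U y∈U r<K)) (P-agrees (inj₁ y∈U) r<K)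
    Q-agrees {K} (inj₂ refl) _  = trans (Q-b (stage K)) (sym g-b)

    g-LIP-a : LIP (UWith x a b a) g
    g-LIP-a = LIP-by-approximation (P ∘ stage) (P-poly ∘ stage) P-agrees

    g-LIP-b : LIP (UWith x a b b) g
    g-LIP-b = LIP-by-approximation (Q ∘ stage) (Q-poly ∘ stage) Q-agrees

open import Defs
open import Data.Nat using (ℕ; _≤_; _≥_; _+_)
open import Data.Integer using (ℤ; _-_; ∣_∣)
open import Data.Fin using (Fin)
open import Data.List using (length)
open import Data.Product using (Σ; _×_; _,_)
open import Function.Definitions using (Injective)
open import Relation.Binary.PropositionalEquality using (_≡_; _≢_)
open import Relation.Nullary using (¬_)

theorem8 : (n : ℕ) (x : Fin n → ℤ) (a b : ℤ) (f : ℤ → ℤ) →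
    Injective _≡_ _≡_ x →
    ((i : Fin n) → x i ≢ a) →
    ((i : Fin n) → x i ≢ b) →
    a ≢ b →
    ¬ (Σ Poly λ p → length p ≤ 2 + n ×
        ((i : Fin n) → eval p (x i) ≡ f (x i)) × eval p a ≡ f a × eval p b ≡ f b) →
    (Σ Poly λ p → ((i : Fin n) → eval p (x i) ≡ f (x i)) × eval p a ≡ f a) →
    (Σ Poly λ p → ((i : Fin n) → eval p (x i) ≡ f (x i)) × eval p b ≡ f b) →
    (∣ a - b ∣ ≥ 2) ×
    (Σ (ℤ → ℤ) λ g →
      ((i : Fin n) → g (x i) ≡ f (x i)) × g a ≡ f a × g b ≡ f b ×
      LIP (UWith x a b a) g × LIP (UWith x a b b) g)
theorem8 n x a b f x-injective _ x≢b a≢b no-interpolant (p , p-nodes , p-a) (q , q-nodes , q-b) =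
  separated no-interpolant , g , g-nodes , g-a , g-b , g-LIP-a , g-LIP-b
  where
  open Interpolation.Construction x a b f x-injective x≢b a≢b p p-nodes p-a q q-nodes q-b
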